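{- Let $n\ge1$, $q\ge 2$ and $i_0,\dots,i_{q-1}\in Q_q$. In the layer-latin $(n+1)$-cube $C$ of order $q$ whose layers are $L[\varepsilon_{i_0},n],L[\varepsilon_{i_1},n],\dots,L[\varepsilon_{i_{q-1}},n]$, every cell is contained in the same number of transversals of $C$.
   Context: $Q_q=\{0,\dots,q-1\}$, $+$ is addition modulo $q$, and $\varepsilon_i$ is the permutation $x\mapsto x+i$ of $Q_q$. A latin $n$-cube of order $q$ is a map $Q_q^n\to Q_q$ such that every line contains all $q$ symbols. For a permutation $\pi$ of $Q_q$, $L[\pi,n]$ is the latin $n$-cube $(x_1,\dots,x_n)\mapsto \pi(x_1)+x_2+\dots+x_n$. A layer-latin $(n+1)$-cube of order $q$ is an array of size $q\times\cdots\times q$ ($n+1$ dimensions) over $Q_q$ each of whose layers (first coordinate fixed) is a latin $n$-cube; its hyperplanes are the cell sets obtained by fixing any one of its $n+1$ coordinates; a transversal is a set of $q$ cells with at most one cell in each hyperplane and pairwise distinct symbols. -}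

module Defs where

open import Data.Nat using (ℕ; zero; suc; _+_; _%_; NonZero)
open import Data.Nat.Properties using () renaming (_≟_ to _≟ℕ_)
open import Data.Fin using (Fin; toℕ)
open import Data.Fin.Properties using (all?) renaming (_≟_ to _≟F_)
open import Data.Vec using (Vec; []; _∷_; lookup; head; tail; foldr)
open import Data.Vec.Properties using (≡-dec)
open import Data.Vec.Membership.Propositional using (_∈_)
import Data.Vec.Membership.DecPropositional as VecMem
open import Data.List using (List; [_]; concatMap; map; filter; length; allFin)
open import Data.Product using (_×_)
open import Relation.Nullary using (¬_; Dec)
open import Relation.Nullary.Decidable using (_×-dec_; _→-dec_; ¬?)
open import Relation.Binary.PropositionalEquality using (_≡_)

-- Q_q is represented by Fin q; addition modulo q is computed via toℕ and _%_.

-- A cell of an (n+1)-dimensional array of order q: (x₀ , x₁ , … , xₙ),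
-- where x₀ (the head) is the first coordinate, i.e. the layer index.
Cell : ℕ → ℕ → Set
Cell q n = Vec (Fin q) (suc n)

sumℕ : ∀ {q m} → Vec (Fin q) m → ℕ
sumℕ = foldr _ (λ x s → toℕ x + s) 0

-- The layer-latin (n+1)-cube C whose layer x₀ is L[ε_{i x₀}, n]:
--   C(x₀, x₁, …, xₙ) = ε_{i x₀}(x₁) + x₂ + … + xₙ = i(x₀) + x₁ + … + xₙ  (mod q).
layerCube : ∀ {q n} .{{_ : NonZero q}} → (Fin q → Fin q) → Cell q n → ℕ
layerCube {q} i c = (toℕ (i (head c)) + sumℕ (tail c)) % q

-- A transversal is a set of q cells, at most one in each hyperplane, with
-- pairwise distinct symbols.  Since its q cells lie in distinct layers, it has
-- exactly one cell in each layer; we represent the set canonically by the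
-- vector T whose k-th entry is its cell in layer k.
IsTransversal : ∀ {q n} .{{_ : NonZero q}} → (Fin q → Fin q) → Vec (Cell q n) q → Set
IsTransversal {q} {n} i T =
  ((k : Fin q) → head (lookup T k) ≡ k) ×
  (((j : Fin (suc n)) (k l : Fin q) → ¬ (k ≡ l) →
       ¬ (lookup (lookup T k) j ≡ lookup (lookup T l) j)) ×
   ((k l : Fin q) → ¬ (k ≡ l) →
       ¬ (layerCube i (lookup T k) ≡ layerCube i (lookup T l))))

isTransversal? : ∀ {q n} .{{_ : NonZero q}} (i : Fin q → Fin q) (T : Vec (Cell q n) q) →
                 Dec (IsTransversal i T)
isTransversal? i T =
  all? (λ k → head (lookup T k) ≟F k) ×-dec
  (all? (λ j → all? (λ k → all? (λ l → ¬? (k ≟F l) →-dec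
        ¬? (lookup (lookup T k) j ≟F lookup (lookup T l) j)))) ×-dec
   all? (λ k → all? (λ l → ¬? (k ≟F l) →-dec
        ¬? (layerCube i (lookup T k) ≟ℕ layerCube i (lookup T l)))))

allVecs : ∀ {A : Set} → List A → (m : ℕ) → List (Vec A m)
allVecs xs zero = [ [] ]
allVecs xs (suc m) = concatMap (λ x → map (x ∷_) (allVecs xs m)) xs

allCells : (q n : ℕ) → List (Cell q n)
allCells q n = allVecs (allFin q) (suc n)

-- All candidate vectors of q cells (each transversal appears exactly once among them).
allCandidates : (q n : ℕ) → List (Vec (Cell q n) q)
allCandidates q n = allVecs (allCells q n) q

_∈?_ : ∀ {q n} (x : Cell q n) (T : Vec (Cell q n) q) → Dec (x ∈ T)
_∈?_ {q} {n} x T = VecMem._∈?_ (≡-dec _≟F_) x T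

numTransversalsThrough : ∀ {q n} .{{_ : NonZero q}} → (Fin q → Fin q) → Cell q n → ℕ
numTransversalsThrough {q} {n} i x =
  length (filter (λ T → isTransversal? i T ×-dec (x ∈? T)) (allCandidates q n))

module Submission where

-- Translating the coordinate x_j (1 ≤ j ≤ n) of every cell by 1 fixes each layer and changes
-- every symbol from s to s + 1, so it maps transversals to transversals bijectively.  Since these
-- translations move any cell of a layer to any other, the number N(x) of transversals through x
-- depends only on the layer of x.  A transversal meets layer k in exactly one cell, so summing N
-- over the q^n cells of layer k counts every transversal once: q^n · N_k is the total number of
-- transversals for every k, and all N_k coincide.

open import Defs
open import Algebra.Properties.CommutativeSemigroup using (interchange)
open import Data.Bool using (true; false)
open import Data.Fin using (Fin; zero; suc; toℕ; fromℕ; inject₁) renaming (_≟_ to _≟F_)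
open import Data.Fin.Induction using (<-weakInduction)
open import Data.Fin.Properties using (toℕ-fromℕ<; toℕ-fromℕ; toℕ-inject₁; toℕ<n; toℕ-injective)
open import Data.List using (List; []; _∷_; [_]; _++_; map; filter; length; concatMap; tabulate; allFin)
open import Data.List.Membership.Propositional using () renaming (_∈_ to _∈ˡ_)
open import Data.List.Membership.Propositional.Properties using (∈-allFin)
open import Data.List.Properties
  using (filter-++; length-++; filter-accept; filter-reject; filter-none; filter-≐; length-filter;
         map-cong; map-∘; map-id; map-tabulate; tabulate-cong; concatMap-cong; concatMap-map; map-concatMap)
open import Data.List.Relation.Binary.BagAndSetEquality using (>>=-cong; ↭⇒∼bag; ∼bag⇒↭)
open import Data.List.Relation.Binary.Permutation.Propositional
  using (_↭_; ↭-refl; ↭-reflexive; ↭-sym; ↭-trans; prep; swap; module PermutationReasoning)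
open import Data.List.Relation.Binary.Permutation.Propositional.Properties
  using (filter-↭; ↭-length; map⁺)
open import Data.List.Relation.Unary.All as All using (All)
open import Data.List.Relation.Unary.Any using (here; there)
open import Data.List.Relation.Unary.Unique.Propositional using (Unique; _∷_)
open import Data.List.Relation.Unary.Unique.Propositional.Properties using (allFin⁺)
open import Data.Nat using (ℕ; zero; suc; _+_; _*_; _%_; _≤_; NonZero; >-nonZero; s≤s)
open import Data.Nat.DivMod using (_mod_; %-distribˡ-+; [m+n]%n≡m%n; m%n%n≡m%n; m<n⇒m%n≡m; n%n≡0)
open import Data.Nat.ListAction using (sum)
open import Data.Nat.Properties using (+-comm; +-suc; *-zeroʳ; *-cancelˡ-≡; +-commutativeSemigroup)
open import Data.Product using (_×_; _,_; proj₁; proj₂)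
open import Data.Product.Function.NonDependent.Propositional using (_×-⇔_)
open import Data.Vec as Vec using (Vec; []; _∷_; lookup; head; tail; updateAt; replicate)
open import Data.Vec.Membership.Propositional using (_∈_)
open import Data.Vec.Membership.Propositional.Properties using (∈-map⁺; ∈-lookup)
open import Data.Vec.Properties using (≡-dec; ∷-injectiveˡ; ∷-injectiveʳ; lookup-map)
  renaming (tabulate∘lookup to tabulate∘lookupᵥ; tabulate-cong to tabulate-congᵥ)
open import Data.Vec.Relation.Unary.Any as Any using (here; there)
open import Data.Vec.Relation.Unary.Any.Properties using (lookup-index)
open import Function using (_∘_; id; _⇔_; mk⇔; Equivalence)
open import Level using (Level)
open import Relation.Binary using (DecidableEquality)
open import Relation.Binary.PropositionalEquality
  using (_≡_; _≢_; refl; sym; trans; cong; cong₂; subst; ≢-sym; module ≡-Reasoning)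
open import Relation.Nullary using (¬_; Dec; yes; no; does)
open import Relation.Nullary.Decidable using (_×-dec_)
open import Relation.Unary using (Pred; Decidable; ∁)

open Equivalence using (to; from)

private
  variable
    a b ℓ ℓ′ : Level
    A B : Set a
    m : ℕ

count : {P : Pred A ℓ} → Decidable P → List A → ℕ
count P? = length ∘ filter P?

module _ {P : Pred A ℓ} (P? : Decidable P) where

  count-++ : ∀ xs ys → count P? (xs ++ ys) ≡ count P? xs + count P? ys
  count-++ xs ys = trans (cong length (filter-++ P? xs ys)) (length-++ (filter P? xs))

  count-∷ : ∀ x xs → count P? (x ∷ xs) ≡ count P? [ x ] + count P? xs
  count-∷ x = count-++ [ x ]

  count-[]-accept : ∀ {x} → P x → count P? [ x ] ≡ 1
  count-[]-accept px = cong length (filter-accept P? px)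

  count-[]-reject : ∀ {x} → ¬ P x → count P? [ x ] ≡ 0
  count-[]-reject ¬px = cong length (filter-reject P? ¬px)

  count-none : ∀ {xs} → All (∁ P) xs → count P? xs ≡ 0
  count-none ¬ps = cong length (filter-none P? ¬ps)

  count-↭ : ∀ {xs ys} → xs ↭ ys → count P? xs ≡ count P? ys
  count-↭ xs↭ys = ↭-length (filter-↭ P? xs↭ys)

  count-map : (f : B → A) → ∀ xs → count P? (map f xs) ≡ count (P? ∘ f) xs
  count-map f [] = refl
  count-map f (x ∷ xs) with does (P? (f x))
  ... | true  = cong suc (count-map f xs)
  ... | false = count-map f xs

  count-concatMap : (f : B → List A) → ∀ xs →
                    count P? (concatMap f xs) ≡ sum (map (count P? ∘ f) xs)
  count-concatMap f [] = refl
  count-concatMap f (x ∷ xs) =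
    trans (count-++ (f x) (concatMap f xs)) (cong (count P? (f x) +_) (count-concatMap f xs))

  count≡sum : ∀ xs → count P? xs ≡ sum (map (λ x → count P? [ x ]) xs)
  count≡sum [] = refl
  count≡sum (x ∷ xs) = trans (count-∷ x xs) (cong (count P? [ x ] +_) (count≡sum xs))

module _ {P : Pred A ℓ} {Q : Pred A ℓ′} (P? : Decidable P) (Q? : Decidable Q) where

  count-⇔ : (∀ x → P x ⇔ Q x) → ∀ xs → count P? xs ≡ count Q? xs
  count-⇔ P⇔Q xs = cong length (filter-≐ P? Q? ((λ {x} → to (P⇔Q x)) , (λ {x} → from (P⇔Q x))) xs)

module _ {P : Pred A ℓ} {Q : Pred B ℓ′} (P? : Decidable P) (Q? : Decidable Q) where

  count-[]-⇔ : ∀ {x y} → P x ⇔ Q y → count P? [ x ] ≡ count Q? [ y ]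
  count-[]-⇔ {x} {y} Px⇔Qy = by-cases (Q? y)
    where
    by-cases : Dec (Q y) → count P? [ x ] ≡ count Q? [ y ]
    by-cases (yes qy) = trans (count-[]-accept P? (from Px⇔Qy qy)) (sym (count-[]-accept Q? qy))
    by-cases (no ¬qy) = trans (count-[]-reject P? (¬qy ∘ to Px⇔Qy)) (sym (count-[]-reject Q? ¬qy))

sum-map-+ : (f g : A → ℕ) → ∀ xs →
            sum (map (λ x → f x + g x) xs) ≡ sum (map f xs) + sum (map g xs)
sum-map-+ f g [] = refl
sum-map-+ f g (x ∷ xs) = begin
  f x + g x + sum (map (λ x → f x + g x) xs)      ≡⟨ cong (f x + g x +_) (sum-map-+ f g xs) ⟩
  f x + g x + (sum (map f xs) + sum (map g xs))   ≡⟨ interchange +-commutativeSemigroup (f x) (g x) _ _ ⟩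
  f x + sum (map f xs) + (g x + sum (map g xs))   ∎
  where open ≡-Reasoning

sum-map-const : ∀ {f : A → ℕ} {c} → (∀ x → f x ≡ c) → ∀ xs → sum (map f xs) ≡ length xs * c
sum-map-const f≡c [] = refl
sum-map-const f≡c (x ∷ xs) = cong₂ _+_ (f≡c x) (sum-map-const f≡c xs)

module _ {B : Set b} (_≟_ : DecidableEquality B) where

  record IsEnumeration (ys : List B) : Set b where
    field occurs-once : ∀ y → count (y ≟_) ys ≡ 1

  open IsEnumeration public

  unique⇒isEnumeration : ∀ {ys} → Unique ys → (∀ y → y ∈ˡ ys) → IsEnumeration ys
  unique⇒isEnumeration u complete = record { occurs-once = λ y → count≡1 u (complete y) }
    where
    count≡1 : ∀ {y ys} → Unique ys → y ∈ˡ ys → count (y ≟_) ys ≡ 1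
    count≡1 {y} (y∉ys ∷ _) (here refl) = trans (count-∷ (y ≟_) y _)
      (cong₂ _+_ (count-[]-accept (y ≟_) refl) (count-none (y ≟_) y∉ys))
    count≡1 {y} (z∉ys ∷ u) (there y∈ys) = trans (count-∷ (y ≟_) _ _)
      (cong₂ _+_ (count-[]-reject (y ≟_) (≢-sym (All.lookup z∉ys y∈ys))) (count≡1 u y∈ys))

  isEnumeration⇒nonZero : ∀ {ys} → IsEnumeration ys → B → NonZero (length ys)
  isEnumeration⇒nonZero {ys} enum y =
    >-nonZero (subst (_≤ length ys) (occurs-once enum y) (length-filter (y ≟_) ys))

  module _ {ys} (enum : IsEnumeration ys) {P : Pred A ℓ} (P? : Decidable P) (f : A → B) where

    count-fibres : ∀ xs → sum (map (λ y → count (λ x → P? x ×-dec (f x ≟ y)) xs) ys) ≡ count P? xs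
    count-fibres [] = trans (sum-map-const (λ _ → refl) ys) (*-zeroʳ (length ys))
    count-fibres (x ∷ xs) = begin
      sum (map (λ y → count (Q? y) (x ∷ xs)) ys)
        ≡⟨ cong sum (map-cong (λ y → count-∷ (Q? y) x xs) ys) ⟩
      sum (map (λ y → count (Q? y) [ x ] + count (Q? y) xs) ys)
        ≡⟨ sum-map-+ (λ y → count (Q? y) [ x ]) (λ y → count (Q? y) xs) ys ⟩
      sum (map (λ y → count (Q? y) [ x ]) ys) + sum (map (λ y → count (Q? y) xs) ys)
        ≡⟨ cong₂ _+_ (fibre (P? x)) (count-fibres xs) ⟩
      count P? [ x ] + count P? xs
        ≡⟨ count-∷ P? x xs ⟨
      count P? (x ∷ xs) ∎
      where
      open ≡-Reasoning
      Q? : ∀ y → Decidable (λ x → P x × f x ≡ y)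
      Q? y x = P? x ×-dec (f x ≟ y)
      fibre : Dec (P x) → sum (map (λ y → count (Q? y) [ x ]) ys) ≡ count P? [ x ]
      fibre (yes px) = begin
        sum (map (λ y → count (Q? y) [ x ]) ys)
          ≡⟨ cong sum (map-cong (λ y → count-[]-⇔ (Q? y) (f x ≟_) (mk⇔ proj₂ (px ,_))) ys) ⟩
        sum (map (λ y → count (f x ≟_) [ y ]) ys)   ≡⟨ count≡sum (f x ≟_) ys ⟨
        count (f x ≟_) ys                           ≡⟨ occurs-once enum (f x) ⟩
        1                                           ≡⟨ count-[]-accept P? px ⟨
        count P? [ x ]                              ∎
      fibre (no ¬px) = begin
        sum (map (λ y → count (Q? y) [ x ]) ys)
          ≡⟨ sum-map-const (λ y → count-[]-reject (Q? y) (¬px ∘ proj₁)) ys ⟩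
        length ys * 0                               ≡⟨ *-zeroʳ (length ys) ⟩
        0                                           ≡⟨ count-[]-reject P? ¬px ⟨
        count P? [ x ]                              ∎

concatMap-↭ : ∀ {A B : Set a} {xs ys : List A} {f g : A → List B} →
              xs ↭ ys → (∀ x → f x ↭ g x) → concatMap f xs ↭ concatMap g ys
concatMap-↭ xs↭ys f↭g = ∼bag⇒↭ (>>=-cong (↭⇒∼bag xs↭ys) (↭⇒∼bag ∘ f↭g))

Permutes : {A : Set a} → (A → A) → List A → Set a
Permutes f xs = map f xs ↭ xs

id-permutes : (xs : List A) → Permutes id xs
id-permutes xs = ↭-reflexive (map-id xs)

module _ {A : Set} where

  allVecs-∷-permutes : ∀ {xs m} {f : A → A} {g : Vec A m → Vec A m} {h : Vec A (suc m) → Vec A (suc m)} →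
                       Permutes f xs → Permutes g (allVecs xs m) →
                       (∀ x v → h (x ∷ v) ≡ f x ∷ g v) → Permutes h (allVecs xs (suc m))
  allVecs-∷-permutes {xs} {m} {f} {g} {h} f-perm g-perm split = begin
    map h (concatMap (λ x → map (x ∷_) V) xs)           ≡⟨ map-concatMap h _ xs ⟩
    concatMap (λ x → map h (map (x ∷_) V)) xs          ≡⟨ concatMap-cong shift xs ⟩
    concatMap (λ x → map (f x ∷_) (map g V)) xs        ≡⟨ concatMap-map _ f xs ⟨
    concatMap (λ y → map (y ∷_) (map g V)) (map f xs)
      ↭⟨ concatMap-↭ f-perm (λ y → map⁺ (y ∷_) g-perm) ⟩
    concatMap (λ y → map (y ∷_) V) xs                  ∎
    where
    open PermutationReasoning
    V = allVecs xs m
    shift : ∀ x → map h (map (x ∷_) V) ≡ map (f x ∷_) (map g V)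
    shift x = trans (sym (map-∘ V)) (trans (map-cong (split x) V) (map-∘ V))

  allVecs-map-permutes : ∀ {xs} {f : A → A} → Permutes f xs →
                         ∀ m → Permutes (Vec.map f) (allVecs xs m)
  allVecs-map-permutes f-perm zero = ↭-refl
  allVecs-map-permutes f-perm (suc m) =
    allVecs-∷-permutes f-perm (allVecs-map-permutes f-perm m) (λ _ _ → refl)

  allVecs-updateAt-permutes : ∀ {xs} {f : A → A} → Permutes f xs →
                              ∀ {m} (j : Fin m) → Permutes (λ v → updateAt v j f) (allVecs xs m)
  allVecs-updateAt-permutes {xs} f-perm {suc m} zero =
    allVecs-∷-permutes f-perm (id-permutes (allVecs xs m)) (λ _ _ → refl)
  allVecs-updateAt-permutes {xs} f-perm (suc j) =
    allVecs-∷-permutes (id-permutes xs) (allVecs-updateAt-permutes f-perm j) (λ _ _ → refl)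

module _ {A : Set} (_≟_ : DecidableEquality A) where

  allVecs-isEnumeration : ∀ {xs} → IsEnumeration _≟_ xs →
                          ∀ m → IsEnumeration (≡-dec _≟_) (allVecs xs m)
  allVecs-isEnumeration {xs} enum m = record { occurs-once = occurs-once-allVecs m }
    where
    occurs-once-allVecs : ∀ m (v : Vec A m) → count (≡-dec _≟_ v) (allVecs xs m) ≡ 1
    occurs-once-allVecs zero [] = count-[]-accept (≡-dec _≟_ []) refl
    occurs-once-allVecs (suc m) (y ∷ w) = begin
      count (≡-dec _≟_ (y ∷ w)) (concatMap (λ x → map (x ∷_) V) xs)  ≡⟨ count-concatMap _ _ xs ⟩
      sum (map (λ x → count (≡-dec _≟_ (y ∷ w)) (map (x ∷_) V)) xs)  ≡⟨ cong sum (map-cong layer xs) ⟩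
      sum (map (λ x → count (y ≟_) [ x ]) xs)                        ≡⟨ count≡sum (y ≟_) xs ⟨
      count (y ≟_) xs                                                ≡⟨ occurs-once enum y ⟩
      1                                                              ∎
      where
      open ≡-Reasoning
      V = allVecs xs m
      head-matches : ∀ x → Dec (y ≡ x) →
                     count (λ v → ≡-dec _≟_ (y ∷ w) (x ∷ v)) V ≡ count (y ≟_) [ x ]
      head-matches x (yes refl) = begin
        count (λ v → ≡-dec _≟_ (y ∷ w) (y ∷ v)) V
          ≡⟨ count-⇔ _ (≡-dec _≟_ w) (λ v → mk⇔ ∷-injectiveʳ (cong (y ∷_))) V ⟩
        count (≡-dec _≟_ w) V                     ≡⟨ occurs-once-allVecs m w ⟩
        1                                         ≡⟨ count-[]-accept (y ≟_) refl ⟨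
        count (y ≟_) [ y ]                        ∎
      head-matches x (no y≢x) = trans
        (count-none _ (All.universal (λ v → y≢x ∘ ∷-injectiveˡ) V))
        (sym (count-[]-reject (y ≟_) y≢x))
      layer : ∀ x → count (≡-dec _≟_ (y ∷ w)) (map (x ∷_) V) ≡ count (y ≟_) [ x ]
      layer x = trans (count-map _ (x ∷_) V) (head-matches x (y ≟ x))

%-+-congʳ : ∀ a {b c} d .{{_ : NonZero d}} → b % d ≡ c % d → (a + b) % d ≡ (a + c) % d
%-+-congʳ a {b} {c} d b≡c = begin
  (a + b) % d          ≡⟨ %-distribˡ-+ a b d ⟩
  (a % d + b % d) % d  ≡⟨ cong (λ r → (a % d + r) % d) b≡c ⟩
  (a % d + c % d) % d  ≡⟨ %-distribˡ-+ a c d ⟨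
  (a + c) % d          ∎
  where open ≡-Reasoning

%-+-congˡ : ∀ {a b} c d .{{_ : NonZero d}} → a % d ≡ b % d → (a + c) % d ≡ (b + c) % d
%-+-congˡ {a} {b} c d a≡b = begin
  (a + c) % d  ≡⟨ cong (_% d) (+-comm a c) ⟩
  (c + a) % d  ≡⟨ %-+-congʳ c d a≡b ⟩
  (c + b) % d  ≡⟨ cong (_% d) (+-comm c b) ⟩
  (b + c) % d  ∎
  where open ≡-Reasoning

suc-%-cancel : ∀ {a b} p → suc a % suc p ≡ suc b % suc p → a % suc p ≡ b % suc p
suc-%-cancel {a} {b} p sa≡sb = begin
  a % suc p            ≡⟨ add-modulus a ⟩
  (p + suc a) % suc p  ≡⟨ %-+-congʳ p (suc p) sa≡sb ⟩
  (p + suc b) % suc p  ≡⟨ add-modulus b ⟨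
  b % suc p            ∎
  where
  open ≡-Reasoning
  add-modulus : ∀ a → a % suc p ≡ (p + suc a) % suc p
  add-modulus a = trans (sym ([m+n]%n≡m%n a (suc p)))
                        (cong (_% suc p) (trans (+-comm a (suc p)) (sym (+-suc p a))))

tabulate-rotate : ∀ {m} (f : Fin (suc m) → A) → tabulate f ↭ f (fromℕ m) ∷ tabulate (f ∘ inject₁)
tabulate-rotate {m = zero} f = ↭-refl
tabulate-rotate {m = suc m} f = ↭-trans (prep (f zero) (tabulate-rotate (f ∘ suc))) (swap _ _ ↭-refl)

module _ {p : ℕ} where

  sucMod : Fin (suc p) → Fin (suc p)
  sucMod x = suc (toℕ x) mod suc p

  toℕ-sucMod : ∀ x → toℕ (sucMod x) ≡ suc (toℕ x) % suc p
  toℕ-sucMod x = toℕ-fromℕ< _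

  sucMod-injective : ∀ {x y} → sucMod x ≡ sucMod y → x ≡ y
  sucMod-injective {x} {y} e = toℕ-injective (begin
    toℕ x          ≡⟨ m<n⇒m%n≡m (toℕ<n x) ⟨
    toℕ x % suc p  ≡⟨ suc-%-cancel p (trans (sym (toℕ-sucMod x)) (trans (cong toℕ e) (toℕ-sucMod y))) ⟩
    toℕ y % suc p  ≡⟨ m<n⇒m%n≡m (toℕ<n y) ⟩
    toℕ y          ∎)
    where open ≡-Reasoning

  sucMod-inject₁ : ∀ (i : Fin p) → sucMod (inject₁ i) ≡ suc i
  sucMod-inject₁ i = toℕ-injective (begin
    toℕ (sucMod (inject₁ i))       ≡⟨ toℕ-sucMod (inject₁ i) ⟩
    suc (toℕ (inject₁ i)) % suc p  ≡⟨ cong (λ r → suc r % suc p) (toℕ-inject₁ i) ⟩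
    suc (toℕ i) % suc p            ≡⟨ m<n⇒m%n≡m (s≤s (toℕ<n i)) ⟩
    suc (toℕ i)                    ∎)
    where open ≡-Reasoning

  sucMod-fromℕ : sucMod (fromℕ p) ≡ zero
  sucMod-fromℕ = toℕ-injective (begin
    toℕ (sucMod (fromℕ p))       ≡⟨ toℕ-sucMod (fromℕ p) ⟩
    suc (toℕ (fromℕ p)) % suc p  ≡⟨ cong (λ r → suc r % suc p) (toℕ-fromℕ p) ⟩
    suc p % suc p                ≡⟨ n%n≡0 (suc p) ⟩
    0                            ∎)
    where open ≡-Reasoning

  sucMod-permutes : Permutes sucMod (allFin (suc p))
  sucMod-permutes = begin
    map sucMod (allFin (suc p))                     ≡⟨ map-tabulate id sucMod ⟩
    tabulate sucMod                                 ↭⟨ tabulate-rotate sucMod ⟩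
    sucMod (fromℕ p) ∷ tabulate (sucMod ∘ inject₁)
      ≡⟨ cong₂ _∷_ sucMod-fromℕ (tabulate-cong sucMod-inject₁) ⟩
    allFin (suc p)                                  ∎
    where open PermutationReasoning

  sucMod-invariant⇒constant : (g : Fin (suc p) → A) → (∀ x → g (sucMod x) ≡ g x) → ∀ x → g x ≡ g zero
  sucMod-invariant⇒constant g invariant = <-weakInduction (λ x → g x ≡ g zero) refl
    (λ i gi≡g0 → trans (cong g (sym (sucMod-inject₁ i))) (trans (invariant (inject₁ i)) gi≡g0))

  updateAt-sucMod-invariant⇒constant : (g : Vec (Fin (suc p)) m → A) →
                                       (∀ j v → g (updateAt v j sucMod) ≡ g v) →
                                       ∀ v → g v ≡ g (replicate m zero)
  updateAt-sucMod-invariant⇒constant g invariant [] = refl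
  updateAt-sucMod-invariant⇒constant g invariant (x ∷ v) = trans
    (sucMod-invariant⇒constant (λ y → g (y ∷ v)) (λ y → invariant zero (y ∷ v)) x)
    (updateAt-sucMod-invariant⇒constant (λ w → g (zero ∷ w)) (λ j w → invariant (suc j) (zero ∷ w)) v)

  sumℕ-updateAt-sucMod : (j : Fin m) (v : Vec (Fin (suc p)) m) →
                         sumℕ (updateAt v j sucMod) % suc p ≡ suc (sumℕ v) % suc p
  sumℕ-updateAt-sucMod zero (x ∷ v) = %-+-congˡ {toℕ (sucMod x)} {suc (toℕ x)} (sumℕ v) (suc p)
    (trans (cong (_% suc p) (toℕ-sucMod x)) (m%n%n≡m%n (suc (toℕ x)) (suc p)))
  sumℕ-updateAt-sucMod (suc j) (x ∷ v) = begin
    (toℕ x + sumℕ (updateAt v j sucMod)) % suc p  ≡⟨ %-+-congʳ (toℕ x) (suc p) (sumℕ-updateAt-sucMod j v) ⟩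
    (toℕ x + suc (sumℕ v)) % suc p                ≡⟨ cong (_% suc p) (+-suc (toℕ x) (sumℕ v)) ⟩
    suc (toℕ x + sumℕ v) % suc p                  ∎
    where open ≡-Reasoning

Separates : {A : Set a} {B : Set b} → (A → B) → Vec A m → Set b
Separates g T = ∀ k l → k ≢ l → g (lookup T k) ≢ g (lookup T l)

separates-map : ∀ {g : A → B} {ψ : A → A} → (∀ c d → g (ψ c) ≡ g (ψ d) ⇔ g c ≡ g d) →
                (T : Vec A m) → Separates g (Vec.map ψ T) ⇔ Separates g T
separates-map {g = g} {ψ} g∘ψ T = mk⇔
  (λ sep k l k≢l e → sep k l k≢l (trans (g-lookup k) (trans (from (g∘ψ _ _) e) (sym (g-lookup l)))))
  (λ sep k l k≢l e → sep k l k≢l (to (g∘ψ _ _) (trans (sym (g-lookup k)) (trans e (g-lookup l)))))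
  where
  g-lookup : ∀ k → g (lookup (Vec.map ψ T) k) ≡ g (ψ (lookup T k))
  g-lookup k = cong g (lookup-map k ψ T)

lookup-updateAt-⇔ : ∀ {f : A → A} → (∀ {x y} → f x ≡ f y → x ≡ y) → (j k : Fin m) (c d : Vec A m) →
                    lookup (updateAt c j f) k ≡ lookup (updateAt d j f) k ⇔ lookup c k ≡ lookup d k
lookup-updateAt-⇔ {f = f} inj zero    zero    (x ∷ c) (y ∷ d) = mk⇔ inj (cong f)
lookup-updateAt-⇔         inj zero    (suc k) (x ∷ c) (y ∷ d) = mk⇔ id id
lookup-updateAt-⇔         inj (suc j) zero    (x ∷ c) (y ∷ d) = mk⇔ id id
lookup-updateAt-⇔         inj (suc j) (suc k) (x ∷ c) (y ∷ d) = lookup-updateAt-⇔ inj j k c d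

lookup-extensionality : ∀ {c d : Vec A m} → (∀ k → lookup c k ≡ lookup d k) → c ≡ d
lookup-extensionality {c = c} {d} c≗d =
  trans (sym (tabulate∘lookupᵥ c)) (trans (tabulate-congᵥ c≗d) (tabulate∘lookupᵥ d))

∈-map⁻ : ∀ {ψ : A → B} → (∀ {x y} → ψ x ≡ ψ y → x ≡ y) →
         ∀ {x} (T : Vec A m) → ψ x ∈ Vec.map ψ T → x ∈ T
∈-map⁻ ψ-injective (t ∷ T) (here ψx≡ψt) = here (ψ-injective ψx≡ψt)
∈-map⁻ ψ-injective (t ∷ T) (there ψx∈T) = there (∈-map⁻ ψ-injective T ψx∈T)

allVecs-allFin-isEnumeration : ∀ {q} m → IsEnumeration (≡-dec _≟F_) (allVecs (allFin q) m)
allVecs-allFin-isEnumeration {q} =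
  allVecs-isEnumeration _≟F_ (unique⇒isEnumeration _≟F_ (allFin⁺ q) ∈-allFin)

module _ {q n : ℕ} .{{_ : NonZero q}} (i : Fin q → Fin q) where

  -- Being a transversal only depends on the layers of the cells and on which of them share a
  -- coordinate or a symbol, so a symmetry only has to preserve these relations.
  record IsSymmetry (ψ : Cell q n → Cell q n) : Set where
    field
      head-ψ         : ∀ c → head (ψ c) ≡ head c
      lookup-ψ       : ∀ k c d → lookup (ψ c) k ≡ lookup (ψ d) k ⇔ lookup c k ≡ lookup d k
      layerCube-ψ    : ∀ c d → layerCube i (ψ c) ≡ layerCube i (ψ d) ⇔ layerCube i c ≡ layerCube i d
      permutes-cells : Permutes ψ (allCells q n)

    injective : ∀ {c d} → ψ c ≡ ψ d → c ≡ d
    injective {c} {d} ψc≡ψd =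
      lookup-extensionality (λ k → to (lookup-ψ k c d) (cong (λ e → lookup e k) ψc≡ψd))

    isTransversal-map : ∀ T → IsTransversal i (Vec.map ψ T) ⇔ IsTransversal i T
    isTransversal-map T = heads ×-⇔ (coordinates ×-⇔ separates-map layerCube-ψ T)
      where
      head-lookup : ∀ k → head (lookup (Vec.map ψ T) k) ≡ head (lookup T k)
      head-lookup k = trans (cong head (lookup-map k ψ T)) (head-ψ (lookup T k))
      heads : (∀ k → head (lookup (Vec.map ψ T) k) ≡ k) ⇔ (∀ k → head (lookup T k) ≡ k)
      heads = mk⇔ (λ h k → trans (sym (head-lookup k)) (h k)) (λ h k → trans (head-lookup k) (h k))
      coordinates : (∀ j → Separates (λ c → lookup c j) (Vec.map ψ T)) ⇔
                    (∀ j → Separates (λ c → lookup c j) T)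
      coordinates = mk⇔ (λ sep j → to (separates-map (lookup-ψ j) T) (sep j))
                        (λ sep j → from (separates-map (lookup-ψ j) T) (sep j))

    numTransversalsThrough-invariant : ∀ x → numTransversalsThrough i (ψ x) ≡ numTransversalsThrough i x
    numTransversalsThrough-invariant x = begin
      count (λ T → isTransversal? i T ×-dec (ψ x ∈? T)) (allCandidates q n)
        ≡⟨ count-↭ _ (↭-sym (allVecs-map-permutes permutes-cells q)) ⟩
      count (λ T → isTransversal? i T ×-dec (ψ x ∈? T)) (map (Vec.map ψ) (allCandidates q n))
        ≡⟨ count-map _ (Vec.map ψ) (allCandidates q n) ⟩
      count (λ T → isTransversal? i (Vec.map ψ T) ×-dec (ψ x ∈? Vec.map ψ T)) (allCandidates q n)
        ≡⟨ count-⇔ _ _ (λ T → isTransversal-map T ×-⇔ mk⇔ (∈-map⁻ injective T) (∈-map⁺ ψ))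
                   (allCandidates q n) ⟩
      count (λ T → isTransversal? i T ×-dec (x ∈? T)) (allCandidates q n)
        ∎
      where open ≡-Reasoning

  ∈⇔lookup-tail : ∀ {T} → IsTransversal i T → ∀ k v → (k ∷ v) ∈ T ⇔ tail (lookup T k) ≡ v
  ∈⇔lookup-tail {T} (heads , _) k v =
    mk⇔ in-layer-k (λ e → subst (_∈ T) (cell≡ (heads k) e) (∈-lookup k T))
    where
    cell≡ : ∀ {c : Cell q n} → head c ≡ k → tail c ≡ v → c ≡ k ∷ v
    cell≡ {_ ∷ _} refl refl = refl
    in-layer-k : (k ∷ v) ∈ T → tail (lookup T k) ≡ v
    in-layer-k kv∈T = cong tail (sym (subst (λ j → k ∷ v ≡ lookup T j) index≡k (lookup-index kv∈T)))
      where
      index≡k : Any.index kv∈T ≡ k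
      index≡k = trans (sym (heads (Any.index kv∈T))) (sym (cong head (lookup-index kv∈T)))

  sum-numTransversalsThrough-layer : ∀ k →
    sum (map (λ v → numTransversalsThrough i (k ∷ v)) (allVecs (allFin q) n)) ≡
    count (isTransversal? i) (allCandidates q n)
  sum-numTransversalsThrough-layer k = trans
    (cong sum (map-cong through-k (allVecs (allFin q) n)))
    (count-fibres (≡-dec _≟F_) (allVecs-allFin-isEnumeration n) (isTransversal? i)
                  (λ T → tail (lookup T k)) (allCandidates q n))
    where
    through-k : ∀ v → numTransversalsThrough i (k ∷ v) ≡
                count (λ T → isTransversal? i T ×-dec ≡-dec _≟F_ (tail (lookup T k)) v) (allCandidates q n)
    through-k v = count-⇔ _ _ (λ T → mk⇔ (λ (t , kv∈T) → t , to (∈⇔lookup-tail t k v) kv∈T)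
                                         (λ (t , e) → t , from (∈⇔lookup-tail t k v) e))
                          (allCandidates q n)

module _ {p n : ℕ} (i : Fin (suc p) → Fin (suc p)) where

  layerCube-shift : ∀ (j : Fin n) c →
                    layerCube i (updateAt c (suc j) sucMod) ≡ suc (layerCube i c) % suc p
  layerCube-shift j (h ∷ v) = begin
    (toℕ (i h) + sumℕ (updateAt v j sucMod)) % suc p
      ≡⟨ %-+-congʳ (toℕ (i h)) (suc p) (sumℕ-updateAt-sucMod j v) ⟩
    (toℕ (i h) + suc (sumℕ v)) % suc p
      ≡⟨ cong (_% suc p) (+-suc (toℕ (i h)) (sumℕ v)) ⟩
    suc (toℕ (i h) + sumℕ v) % suc p
      ≡⟨ %-+-congʳ 1 (suc p) (m%n%n≡m%n (toℕ (i h) + sumℕ v) (suc p)) ⟨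
    suc ((toℕ (i h) + sumℕ v) % suc p) % suc p
      ∎
    where open ≡-Reasoning

  shift-isSymmetry : (j : Fin n) → IsSymmetry i (λ c → updateAt c (suc j) sucMod)
  shift-isSymmetry j = record
    { head-ψ         = λ { (_ ∷ _) → refl }
    ; lookup-ψ       = lookup-updateAt-⇔ sucMod-injective (suc j)
    ; layerCube-ψ    = λ c d → mk⇔ (cancel c d) (shift-cong c d)
    ; permutes-cells = allVecs-updateAt-permutes sucMod-permutes (suc j)
    }
    where
    ψ : Cell (suc p) n → Cell (suc p) n
    ψ c = updateAt c (suc j) sucMod
    shift-cong : ∀ c d → layerCube i c ≡ layerCube i d → layerCube i (ψ c) ≡ layerCube i (ψ d)
    shift-cong c d e =
      trans (layerCube-shift j c) (trans (cong (λ r → suc r % suc p) e) (sym (layerCube-shift j d)))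
    cancel : ∀ c d → layerCube i (ψ c) ≡ layerCube i (ψ d) → layerCube i c ≡ layerCube i d
    cancel c@(hc ∷ vc) d@(hd ∷ vd) e = begin
      layerCube i c          ≡⟨ m%n%n≡m%n (toℕ (i hc) + sumℕ vc) (suc p) ⟨
      layerCube i c % suc p
        ≡⟨ suc-%-cancel p (trans (sym (layerCube-shift j c)) (trans e (layerCube-shift j d))) ⟩
      layerCube i d % suc p  ≡⟨ m%n%n≡m%n (toℕ (i hd) + sumℕ vd) (suc p) ⟩
      layerCube i d          ∎
      where open ≡-Reasoning

  numTransversalsThrough-within-layer : ∀ k v →
    numTransversalsThrough i (k ∷ v) ≡ numTransversalsThrough i (k ∷ replicate n zero)
  numTransversalsThrough-within-layer k = updateAt-sucMod-invariant⇒constant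
    (λ v → numTransversalsThrough i (k ∷ v))
    (λ j v → IsSymmetry.numTransversalsThrough-invariant (shift-isSymmetry j) (k ∷ v))

  length*numTransversalsThrough : ∀ k v →
    length (allVecs (allFin (suc p)) n) * numTransversalsThrough i (k ∷ v) ≡
    count (isTransversal? i) (allCandidates (suc p) n)
  length*numTransversalsThrough k v = begin
    length Vs * numTransversalsThrough i (k ∷ v)           ≡⟨ sum-map-const same-count Vs ⟨
    sum (map (λ w → numTransversalsThrough i (k ∷ w)) Vs)  ≡⟨ sum-numTransversalsThrough-layer {n = n} i k ⟩
    count (isTransversal? i) (allCandidates (suc p) n)     ∎
    where
    open ≡-Reasoning
    Vs = allVecs (allFin (suc p)) n
    same-count : ∀ w → numTransversalsThrough i (k ∷ w) ≡ numTransversalsThrough i (k ∷ v)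
    same-count w =
      trans (numTransversalsThrough-within-layer k w) (sym (numTransversalsThrough-within-layer k v))

  numTransversalsThrough-constant : ∀ (x y : Cell (suc p) n) →
                                    numTransversalsThrough i x ≡ numTransversalsThrough i y
  numTransversalsThrough-constant (k ∷ v) (l ∷ w) = *-cancelˡ-≡ _ _ (length Vs) {{Vs-nonZero}}
    (trans (length*numTransversalsThrough k v) (sym (length*numTransversalsThrough l w)))
    where
    Vs = allVecs (allFin (suc p)) n
    Vs-nonZero : NonZero (length Vs)
    Vs-nonZero = isEnumeration⇒nonZero (≡-dec _≟F_) (allVecs-allFin-isEnumeration n) (replicate n zero)

proposition6 : (n q : ℕ) .{{_ : NonZero q}} → 1 ≤ n → 2 ≤ q →
    (i : Fin q → Fin q) → (x y : Cell q n) →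
    numTransversalsThrough i x ≡ numTransversalsThrough i y
proposition6 n (suc p) _ _ i = numTransversalsThrough-constant i
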